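{- Let $G=M_k$ (for an integer $k\ge 2$) be the $k$-th Mycielski graph, and let $\sigma$ be its canonical proper $k$-colouring. Then there is no independent set of $G$ containing vertices of all $k$ colours of $\sigma$.
   Context: The Mycielski graphs are defined by $M_2=K_2$ (one edge), and for $k\ge3$, $M_k$ is obtained from $M_{k-1}$ by adding, for each vertex $u$ of $M_{k-1}$, a new twin vertex $u'$ adjacent to all neighbours of $u$ in $M_{k-1}$, and then a new vertex $v_0$ adjacent to all the twins. The canonical $k$-colouring of $M_k$ is defined recursively: the canonical colouring of $M_2$ colours its two vertices $1$ and $2$; for $k\ge 3$, $v_0$ receives colour $k$ and each vertex of $M_{k-1}$ and its twin receive the colour of that vertex in the canonical $(k-1)$-colouring of $M_{k-1}$. -}

module Defs where

open import Data.Nat using (ℕ; zero; suc; _+_; _≤_)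
open import Data.Fin using (Fin; zero; suc)
open import Data.Product using (Σ; _×_)
open import Data.Empty using (⊥)
open import Relation.Binary.PropositionalEquality using (_≡_)
open import Relation.Nullary using (¬_)

-- Vertices of the Mycielski graph M_k, indexed by n = k - 2 (so k ≥ 2 built in).
--   MV 0       : the two vertices of M_2 = K_2
--   MV (suc n) : vertices of M_{n+3} = old copy of M_{n+2}, twins, and apex v0
data MV : ℕ → Set where
  base : Fin 2 → MV 0
  old  : ∀ {n} → MV n → MV (suc n)
  twin : ∀ {n} → MV n → MV (suc n)
  apex : ∀ {n} → MV (suc n)

data Adj : ∀ {n} → MV n → MV n → Set where
  k2-01    : Adj (base zero) (base (suc zero))
  k2-10    : Adj (base (suc zero)) (base zero)
  old-old  : ∀ {n} {u v : MV n} → Adj u v → Adj (old u) (old v)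
  old-twin : ∀ {n} {u v : MV n} → Adj u v → Adj (old u) (twin v)
  twin-old : ∀ {n} {u v : MV n} → Adj u v → Adj (twin u) (old v)
  apex-twin : ∀ {n} {u : MV n} → Adj apex (twin u)
  twin-apex : ∀ {n} {u : MV n} → Adj (twin u) apex

canon : ∀ {n} → MV n → ℕ
canon (base zero) = 1
canon (base (suc zero)) = 2
canon (old u) = canon u
canon (twin u) = canon u
canon (apex {n}) = suc n + 2

Independent : ∀ {n} → (MV n → Set) → Set
Independent {n} S = ∀ (u v : MV n) → S u → S v → ¬ Adj u v

AllColours : ∀ {n} → (MV n → Set) → Set
AllColours {n} S = ∀ (c : ℕ) → 1 ≤ c → c ≤ n + 2 → Σ (MV n) (λ u → S u × canon u ≡ c)

{-# OPTIONS --safe #-}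
module Submission where

-- Colour k of the canonical colouring of M_k is carried only by the apex v₀, so an
-- independent set meeting every colour contains v₀ and therefore no twin. Its colours
-- 1, …, k-1 are then met inside the old copy of M_{k-1}, an induced subgraph, and
-- induction on k reduces the claim to K₂, where both vertices would have to be chosen.

open import Defs
open import Data.Nat using (ℕ; zero; suc; _+_; _≤_; z≤n; s≤s)
open import Data.Nat.Properties using (≤-refl; ≤-trans; n≤1+n; 1+n≰n)
open import Data.Fin using (zero; suc)
open import Data.Product using (_×_; _,_)
open import Data.Empty using (⊥-elim)
open import Function using (_∘_)
open import Relation.Binary.PropositionalEquality using (_≡_; refl; subst; sym)
open import Relation.Nullary using (¬_)

canon-≤ : ∀ {n} (u : MV n) → canon u ≤ n + 2
canon-≤ (base zero)       = s≤s z≤n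
canon-≤ (base (suc zero)) = ≤-refl
canon-≤ (old u)           = ≤-trans (canon-≤ u) (n≤1+n _)
canon-≤ (twin u)          = ≤-trans (canon-≤ u) (n≤1+n _)
canon-≤ apex              = ≤-refl

canon≡top⇒apex : ∀ {n} (u : MV (suc n)) → canon u ≡ suc n + 2 → u ≡ apex
canon≡top⇒apex (old u)  eq = ⊥-elim (1+n≰n (subst (_≤ _) eq (canon-≤ u)))
canon≡top⇒apex (twin u) eq = ⊥-elim (1+n≰n (subst (_≤ _) eq (canon-≤ u)))
canon≡top⇒apex apex     _  = refl

AllColours⇒apex : ∀ {n} {S : MV (suc n) → Set} → AllColours S → S apex
AllColours⇒apex {n} {S} all with all (suc n + 2) (s≤s z≤n) ≤-refl
... | u , u∈S , eq = subst S (canon≡top⇒apex u eq) u∈S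

Independent-old : ∀ {n} {S : MV (suc n) → Set} → Independent S → Independent (S ∘ old)
Independent-old ind u v u∈S v∈S u~v = ind _ _ u∈S v∈S (old-old u~v)

AllColours-old : ∀ {n} {S : MV (suc n) → Set} →
                 Independent S → AllColours S → AllColours (S ∘ old)
AllColours-old {n} ind all c 1≤c c≤n+2 with all c 1≤c (≤-trans c≤n+2 (n≤1+n _))
... | old v  , v∈S , eq = v , v∈S , eq
... | twin v , v∈S , _  = ⊥-elim (ind _ _ (AllColours⇒apex all) v∈S apex-twin)
... | apex   , _   , eq = ⊥-elim (1+n≰n (subst (_≤ n + 2) (sym eq) c≤n+2))

K₂-Independent⇒¬AllColours : (S : MV 0 → Set) → Independent S → ¬ AllColours S
K₂-Independent⇒¬AllColours S ind all with all 1 ≤-refl (s≤s z≤n) | all 2 (s≤s z≤n) ≤-refl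
... | base zero       , 1∈S , _  | base (suc zero) , 2∈S , _ = ind _ _ 1∈S 2∈S k2-01
... | base zero       , _   , _  | base zero       , _   , ()
... | base (suc zero) , _   , () | _

proposition3p1 : (n : ℕ) → (S : MV n → Set) → ¬ (Independent S × AllColours S)
proposition3p1 zero    S (ind , all) = K₂-Independent⇒¬AllColours S ind all
proposition3p1 (suc n) S (ind , all) =
  proposition3p1 n (S ∘ old) (Independent-old ind , AllColours-old ind all)
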